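{- The sequence $(q_{2,j})_{j\in\mathbb Z^{\geq 0}}$ is a permutation of $\mathbb Z^{\geq 0}$, and every integer appears exactly once in the sequence $(q_{2,j}-j)_{j\in\mathbb Z^{\geq 0}}$.
   Context: For a set $X\subseteq\mathbb Z^{\geq 0}$, $\mathrm{mex}(X)=\min(\mathbb Z^{\geq0}\setminus X)$. Define nonnegative integers $q_{i,j}$ for $i,j\in\mathbb Z^{\geq 0}$ recursively (in order of increasing $i$, and for fixed $i$ increasing $j$) by $$q_{i,j}=\mathrm{mex}\big(S_{i,j}\cap\mathbb Z^{\geq 0}\big),\quad S_{i,j}=\{q_{i,k}+q_{l,j}-q_{l,k}\mid 0\leq l<i,\ 0\leq k<j\}.$$ (So $q_{0,j}=q_{i,0}=0$ and $q_{1,j}=j$.) -}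

module Defs where

open import Data.Nat using (ℕ; zero; suc)
open import Data.Integer using (ℤ; +_; _+_; _-_)
open import Data.List using (List; []; _∷_; _++_; [_]; length; upTo; zip; concatMap; map)
open import Data.List.Membership.DecPropositional (Data.Integer._≟_) using (_∈?_)
open import Data.Product using (_,_)
open import Relation.Nullary using (yes; no)

-- mex of a finite list X of integers: least n ∈ ℕ with (+ n) ∉ X,
-- i.e. mex (X ∩ ℤ≥0).  The search starting at 0 with fuel (length X)
-- is exact, since among 0,…,length X some value is missing from X.
mexFrom : ℕ → ℕ → List ℤ → ℕ
mexFrom zero    n X = n
mexFrom (suc f) n X with (+ n) ∈? X
... | yes _ = mexFrom f (suc n) X
... | no  _ = n

mex : List ℤ → ℕ
mex X = mexFrom (length X) 0 X

-- S_{i,j} as a list: prev = rows q_{l,-} for l < i, cur = [q_{i,0},…,q_{i,j-1}]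
S : List (ℕ → ℕ) → List ℕ → ℕ → List ℤ
S prev cur j =
  concatMap (λ r → map (λ { (k , c) → (+ c + + r j) - + r k }) (zip (upTo j) cur)) prev

rowList : List (ℕ → ℕ) → ℕ → List ℕ
rowList prev zero    = []
rowList prev (suc j) = rowList prev j ++ [ mex (S prev (rowList prev j) j) ]

rowFn : List (ℕ → ℕ) → ℕ → ℕ
rowFn prev j = mex (S prev (rowList prev j) j)

prevRows : ℕ → List (ℕ → ℕ)
prevRows zero    = []
prevRows (suc i) = prevRows i ++ [ rowFn (prevRows i) ]

q : ℕ → ℕ → ℕ
q i j = rowFn (prevRows i) j

-- Writing g = q₂, the value g j is the least m that is neither an earlier value g k
-- (row 0 of the recursion) nor on an earlier diagonal, g k − k = m − j (row 1, since
-- q₁ is the identity).  So g and j ↦ g j − j are injective, and a strong induction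
-- shows that g is an involution.  For a diagonal z > 0, if g j ≠ j + z for all
-- j < 2z, then every j < 2z has g j − j strictly between −z and z; these are only
-- 2z − 1 values, contradicting injectivity of the diagonal.  Diagonals z ≤ 0 are
-- reached from diagonals −z ≥ 0 through the involution, which negates g j − j.
module Submission where

open import Defs
open import Data.Nat using (ℕ; zero; suc; _+_; _∸_; _<_; _≤_; _≟_; z≤n; s≤s; s≤s⁻¹)
open import Data.Nat.Properties
open import Data.Nat.Induction using (<-rec)
open import Data.Integer using (ℤ; +_; -[1+_]; _-_)
import Data.Integer as ℤ
import Data.Integer.Properties as ℤ
open import Algebra.Bundles using (AbelianGroup)
open import Algebra.Properties.Group (AbelianGroup.group ℤ.+-0-abelianGroup)
  using (//-rightDividesˡ; //-rightDividesʳ)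
import Algebra.Properties.CommutativeSemigroup as CommSemigroup
open import Data.List using (List; []; _∷_; _++_; [_]; length; upTo; zip; map; lookup)
open import Data.List.Properties using (upTo-∷ʳ; map-++)
open import Data.List.Membership.Propositional using (_∈_; _∉_; find; lose)
open import Data.List.Membership.Propositional.Properties
  using (∈-concatMap⁺; ∈-concatMap⁻; ∈-map⁺; ∈-map⁻; ∈-upTo⁺; ∈-upTo⁻)
open import Data.List.Membership.DecPropositional (ℤ._≟_) using (_∈?_)
open import Data.List.Relation.Unary.Any using (here; there; index; any?)
open import Data.List.Relation.Unary.Any.Properties using (lookup-index; map⁺)
open import Data.Fin using (Fin; toℕ; fromℕ<)
open import Data.Fin.Properties using (pigeonhole; toℕ<n; toℕ-fromℕ<)
open import Data.Product using (∃; ∃₂; ∃-syntax; _×_; _,_)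
open import Data.Sum using (_⊎_; inj₁; inj₂)
open import Data.Empty using (⊥-elim)
open import Function using (_∘_)
open import Function.Definitions using (Bijective)
open import Function.Consequences.Propositional using (strictlySurjective⇒surjective)
open import Relation.Binary.Definitions using (tri<; tri≈; tri>)
open import Relation.Nullary using (¬_; yes; no; contradiction)
open import Relation.Binary.PropositionalEquality
  using (_≡_; _≢_; refl; sym; trans; cong; subst; subst₂; module ≡-Reasoning)

open CommSemigroup +-commutativeSemigroup using (xy∙z≈xz∙y; xy∙z≈zy∙x)
open CommSemigroup ℤ.+-commutativeSemigroup using ()
  renaming (xy∙z≈xz∙y to ℤ-xy∙z≈xz∙y)

[m+n]-o≡p⇒m+n≡p+o : ∀ {m n o p} → (+ m ℤ.+ + n) - + o ≡ + p → m + n ≡ p + o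
[m+n]-o≡p⇒m+n≡p+o {m} {n} {o} {p} e = ℤ.+-injective (begin
  + (m + n)                      ≡⟨ ℤ.pos-+ m n ⟩
  + m ℤ.+ + n                    ≡⟨ //-rightDividesˡ (+ o) _ ⟨
  ((+ m ℤ.+ + n) - + o) ℤ.+ + o  ≡⟨ cong (ℤ._+ + o) e ⟩
  + p ℤ.+ + o                    ≡⟨ ℤ.pos-+ p o ⟨
  + (p + o)                      ∎)
  where open ≡-Reasoning

m+n≡p+o⇒[m+n]-o≡p : ∀ {m n o p} → m + n ≡ p + o → (+ m ℤ.+ + n) - + o ≡ + p
m+n≡p+o⇒[m+n]-o≡p {m} {n} {o} {p} e = begin
  (+ m ℤ.+ + n) - + o  ≡⟨ cong (_- + o) (ℤ.pos-+ m n) ⟨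
  + (m + n) - + o      ≡⟨ cong (λ x → + x - + o) e ⟩
  + (p + o) - + o      ≡⟨ cong (_- + o) (ℤ.pos-+ p o) ⟩
  (+ p ℤ.+ + o) - + o  ≡⟨ //-rightDividesʳ (+ o) (+ p) ⟩
  + p                  ∎
  where open ≡-Reasoning

m-n≡o-p⇒m+p≡o+n : ∀ {m n o p} → + m - + n ≡ + o - + p → m + p ≡ o + n
m-n≡o-p⇒m+p≡o+n {m} {n} {o} {p} e = ℤ.+-injective (begin
  + (m + p)                      ≡⟨ ℤ.pos-+ m p ⟩
  + m ℤ.+ + p                    ≡⟨ cong (ℤ._+ + p) (//-rightDividesˡ (+ n) (+ m)) ⟨
  ((+ m - + n) ℤ.+ + n) ℤ.+ + p  ≡⟨ cong (λ x → (x ℤ.+ + n) ℤ.+ + p) e ⟩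
  ((+ o - + p) ℤ.+ + n) ℤ.+ + p  ≡⟨ ℤ-xy∙z≈xz∙y (+ o - + p) (+ n) (+ p) ⟩
  ((+ o - + p) ℤ.+ + p) ℤ.+ + n  ≡⟨ cong (ℤ._+ + n) (//-rightDividesˡ (+ p) (+ o)) ⟩
  + o ℤ.+ + n                    ≡⟨ ℤ.pos-+ o n ⟨
  + (o + n)                      ∎)
  where open ≡-Reasoning

m∸n≡o∸p⇒m+p≡o+n : ∀ {m n o p} → n ≤ m → p ≤ o → m ∸ n ≡ o ∸ p → m + p ≡ o + n
m∸n≡o∸p⇒m+p≡o+n {m} {n} {o} {p} n≤m p≤o e = begin
  m + p            ≡⟨ cong (_+ p) (m∸n+n≡m n≤m) ⟨
  (m ∸ n + n) + p  ≡⟨ cong (λ x → (x + n) + p) e ⟩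
  (o ∸ p + n) + p  ≡⟨ xy∙z≈xz∙y (o ∸ p) n p ⟩
  (o ∸ p + p) + n  ≡⟨ cong (_+ n) (m∸n+n≡m p≤o) ⟩
  o + n            ∎
  where open ≡-Reasoning

pigeonhole-ℕ : ∀ {M N} (f : ℕ → ℕ) → M < N → (∀ {i} → i < N → f i < M) →
               ∃₂ λ i j → i < j × j < N × f i ≡ f j
pigeonhole-ℕ f M<N f<M with pigeonhole M<N (λ i → fromℕ< (f<M (toℕ<n i)))
... | i , j , i<j , same = toℕ i , toℕ j , i<j , toℕ<n j , (begin
  f (toℕ i)                        ≡⟨ toℕ-fromℕ< (f<M (toℕ<n i)) ⟨
  toℕ (fromℕ< (f<M (toℕ<n i)))     ≡⟨ cong toℕ same ⟩
  toℕ (fromℕ< (f<M (toℕ<n j)))     ≡⟨ toℕ-fromℕ< (f<M (toℕ<n j)) ⟩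
  f (toℕ j)                        ∎)
  where open ≡-Reasoning

symmetric-<-free⇒≡ : {R : ℕ → ℕ → Set} → (∀ {i j} → R i j → R j i) →
                     (∀ {i j} → i < j → ¬ R i j) → ∀ {i j} → R i j → i ≡ j
symmetric-<-free⇒≡ sym-R free {i} {j} r with <-cmp i j
... | tri< i<j _ _ = contradiction r (free i<j)
... | tri≈ _ i≡j _ = i≡j
... | tri> _ _ j<i = contradiction (sym-R r) (free j<i)

pigeonhole-∈ : ∀ {A : Set} (X : List A) (f : ℕ → A) → (∀ {i j} → f i ≡ f j → i ≡ j) →
               ¬ (∀ {i} → i ≤ length X → f i ∈ X)
pigeonhole-∈ X f f-injective f≤∈X with pigeonhole (n<1+n (length X)) position
  where
  position : Fin (suc (length X)) → Fin (length X)
  position i = index (f≤∈X (s≤s⁻¹ (toℕ<n i)))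
... | i , j , i<j , same = <⇒≢ i<j (f-injective (begin
  f (toℕ i)                             ≡⟨ lookup-index (f≤∈X (s≤s⁻¹ (toℕ<n i))) ⟩
  lookup X (index (f≤∈X (s≤s⁻¹ (toℕ<n i)))) ≡⟨ cong (lookup X) same ⟩
  lookup X (index (f≤∈X (s≤s⁻¹ (toℕ<n j)))) ≡⟨ lookup-index (f≤∈X (s≤s⁻¹ (toℕ<n j))) ⟨
  f (toℕ j)                             ∎))
  where open ≡-Reasoning

mexFrom-∈ : ∀ fuel {n i} X → n ≤ i → i < mexFrom fuel n X → + i ∈ X
mexFrom-∈ zero       X n≤i i<n   = contradiction n≤i (<⇒≱ i<n)
mexFrom-∈ (suc fuel) {n} {i} X n≤i i<mex with + n ∈? X
... | no  _   = contradiction n≤i (<⇒≱ i<mex)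
... | yes n∈X with n ≟ i
...   | yes refl = n∈X
...   | no  n≢i  = mexFrom-∈ fuel X (≤∧≢⇒< n≤i n≢i) i<mex

mexFrom-∉⊎exhausted : ∀ fuel n X → + mexFrom fuel n X ∉ X ⊎ mexFrom fuel n X ≡ n + fuel
mexFrom-∉⊎exhausted zero       n X = inj₂ (sym (+-identityʳ n))
mexFrom-∉⊎exhausted (suc fuel) n X with + n ∈? X
... | no  n∉X = inj₁ n∉X
... | yes _   with mexFrom-∉⊎exhausted fuel (suc n) X
...   | inj₁ mex∉X = inj₁ mex∉X
...   | inj₂ mex≡  = inj₂ (trans mex≡ (sym (+-suc n fuel)))

<mex⇒∈ : ∀ X {i} → i < mex X → + i ∈ X
<mex⇒∈ X = mexFrom-∈ (length X) X z≤n

mex-∉ : ∀ X → + mex X ∉ X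
mex-∉ X mex∈X with mexFrom-∉⊎exhausted (length X) 0 X
... | inj₁ mex∉X    = mex∉X mex∈X
... | inj₂ mex≡len = pigeonhole-∈ X +_ ℤ.+-injective ≤len⇒∈
  where
  ≤len⇒∈ : ∀ {i} → i ≤ length X → + i ∈ X
  ≤len⇒∈ i≤len with m≤n⇒m<n∨m≡n i≤len
  ... | inj₁ i<len = <mex⇒∈ X (subst (_ <_) (sym mex≡len) i<len)
  ... | inj₂ refl  = subst (λ v → + v ∈ X) mex≡len mex∈X

rowList≡map : ∀ prev j → rowList prev j ≡ map (rowFn prev) (upTo j)
rowList≡map prev zero    = refl
rowList≡map prev (suc j) = begin
  rowList prev j ++ [ rowFn prev j ]                   ≡⟨ cong (_++ [ rowFn prev j ]) (rowList≡map prev j) ⟩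
  map (rowFn prev) (upTo j) ++ map (rowFn prev) [ j ]  ≡⟨ map-++ (rowFn prev) (upTo j) [ j ] ⟨
  map (rowFn prev) (upTo j ++ [ j ])                   ≡⟨ cong (map (rowFn prev)) (upTo-∷ʳ j) ⟩
  map (rowFn prev) (upTo (suc j))                      ∎
  where open ≡-Reasoning

zip-map-graph : ∀ {A B : Set} (f : A → B) xs → zip xs (map f xs) ≡ map (λ x → x , f x) xs
zip-map-graph f []       = refl
zip-map-graph f (x ∷ xs) = cong ((x , f x) ∷_) (zip-map-graph f xs)

Blocks : List (ℕ → ℕ) → (ℕ → ℕ) → ℕ → ℕ → Set
Blocks prev row j m = ∃[ r ] r ∈ prev × ∃[ k ] k < j × row k + r j ≡ m + r k

∈S⇒Blocks : ∀ prev j {m} → + m ∈ S prev (rowList prev j) j → Blocks prev (rowFn prev) j m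
∈S⇒Blocks prev j m∈S
  rewrite rowList≡map prev j | zip-map-graph (rowFn prev) (upTo j)
  with find (∈-concatMap⁻ _ {xs = prev} m∈S)
... | r , r∈prev , m∈row with ∈-map⁻ _ m∈row
...   | _ , k,gk∈ , m≡ with ∈-map⁻ _ k,gk∈
...     | k , k∈upTo , refl = r , r∈prev , k , ∈-upTo⁻ k∈upTo , [m+n]-o≡p⇒m+n≡p+o {n = r j} {r k} (sym m≡)

Blocks⇒∈S : ∀ prev j {m} → Blocks prev (rowFn prev) j m → + m ∈ S prev (rowList prev j) j
Blocks⇒∈S prev j (r , r∈prev , k , k<j , e)
  rewrite rowList≡map prev j | zip-map-graph (rowFn prev) (upTo j) =
  ∈-concatMap⁺ _ {xs = prev}
    (lose r∈prev (map⁺ (lose (∈-map⁺ (λ x → x , rowFn prev x) (∈-upTo⁺ k<j))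
                                 (sym (m+n≡p+o⇒[m+n]-o≡p {n = r j} {r k} e)))))

rowFn-unblocked : ∀ prev j → ¬ Blocks prev (rowFn prev) j (rowFn prev j)
rowFn-unblocked prev j = mex-∉ _ ∘ Blocks⇒∈S prev j

<rowFn⇒Blocks : ∀ prev j {m} → m < rowFn prev j → Blocks prev (rowFn prev) j m
<rowFn⇒Blocks prev j = ∈S⇒Blocks prev j ∘ <mex⇒∈ _

q₁≡id : ∀ j → q 1 j ≡ j
q₁≡id = <-rec _ λ j ih → ≤-antisym (≮⇒≥ (j≮q₁j ih)) (≮⇒≥ (q₁j≮j ih))
  where
  j≮q₁j : ∀ {j} → (∀ {k} → k < j → q 1 k ≡ k) → ¬ j < q 1 j
  j≮q₁j {j} ih j<q₁j with <rowFn⇒Blocks (q 0 ∷ []) j j<q₁j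
  ... | _ , here refl , k , k<j , e =
    <⇒≢ k<j (trans (sym (ih k<j)) (+-cancelʳ-≡ 0 _ _ e))
  q₁j≮j : ∀ {j} → (∀ {k} → k < j → q 1 k ≡ k) → ¬ q 1 j < j
  q₁j≮j {j} ih q₁j<j =
    rowFn-unblocked (q 0 ∷ []) j (q 0 , here refl , q 1 j , q₁j<j , cong (_+ 0) (ih q₁j<j))

-- m ∈ S_{2,j} for g = q₂, once q₀ = 0 and q₁ = id are substituted
Blocked : (ℕ → ℕ) → ℕ → ℕ → Set
Blocked g j m = ∃[ k ] k < j × (g k ≡ m ⊎ g k + j ≡ m + k)

record IsGreedy (g : ℕ → ℕ) : Set where
  field
    unblocked : ∀ j → ¬ Blocked g j (g j)
    blocked   : ∀ {j m} → m < g j → Blocked g j m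

q₂-greedy : IsGreedy (q 2)
q₂-greedy = record { unblocked = unblocked ; blocked = blocked }
  where
  prev : List (ℕ → ℕ)
  prev = q 0 ∷ q 1 ∷ []
  unblocked : ∀ j → ¬ Blocked (q 2) j (q 2 j)
  unblocked j (k , k<j , inj₁ e) = rowFn-unblocked prev j (q 0 , here refl , k , k<j , cong (_+ 0) e)
  unblocked j (k , k<j , inj₂ e) = rowFn-unblocked prev j
    (q 1 , there (here refl) , k , k<j , subst₂ (λ a b → q 2 k + a ≡ q 2 j + b) (sym (q₁≡id j)) (sym (q₁≡id k)) e)
  blocked : ∀ {j m} → m < q 2 j → Blocked (q 2) j m
  blocked {j} m<q₂j with <rowFn⇒Blocks prev j m<q₂j
  ... | _ , here refl , k , k<j , e = k , k<j , inj₁ (+-cancelʳ-≡ 0 _ _ e)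
  ... | _ , there (here refl) , k , k<j , e =
    k , k<j , inj₂ (subst₂ (λ a b → q 2 k + a ≡ _ + b) (q₁≡id j) (q₁≡id k) e)

module Greedy {g : ℕ → ℕ} (greedy : IsGreedy g) where
  open IsGreedy greedy

  injective : ∀ {i j} → g i ≡ g j → i ≡ j
  injective = symmetric-<-free⇒≡ sym λ {_} {j} i<j e → unblocked j (_ , i<j , inj₁ e)

  diagonal-injective : ∀ {i j} → g i + j ≡ g j + i → i ≡ j
  diagonal-injective = symmetric-<-free⇒≡ sym λ {_} {j} i<j e → unblocked j (_ , i<j , inj₂ e)

  least-unblocked : ∀ {j m} → ¬ Blocked g j m → (∀ {m′} → m′ < m → Blocked g j m′) → g j ≡ m
  least-unblocked {j} {m} m-free below-blocked with <-cmp (g j) m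
  ... | tri< gj<m _ _ = contradiction (below-blocked gj<m) (unblocked j)
  ... | tri≈ _ gj≡m _ = gj≡m
  ... | tri> _ _ m<gj = contradiction (blocked m<gj) m-free

  g0≡0 : g 0 ≡ 0
  g0≡0 = least-unblocked (λ { (_ , () , _) }) (λ ())

  Misses : ℕ → ℕ → Set
  Misses z N = ∀ {k} → k < N → g k ≢ k + z

  misses-before : ∀ {k z} → g k ≡ k + z → Misses z k
  misses-before {k} {z} gk≡k+z {k′} k′<k gk′≡k′+z = <⇒≢ k′<k (diagonal-injective (begin
    g k′ + k     ≡⟨ cong (_+ k) gk′≡k′+z ⟩
    (k′ + z) + k ≡⟨ xy∙z≈zy∙x k′ z k ⟩
    (k + z) + k′ ≡⟨ cong (_+ k′) gk≡k+z ⟨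
    g k + k′     ∎))
    where open ≡-Reasoning

  -- A value above r + z would be blocked either by an earlier value, which is too
  -- small, or by an earlier point of diagonal z.
  ≤diagonal : ∀ {z N r} → Misses z N → r < N → g r ≤ r + z
  ≤diagonal {z} {N} {r} miss = <-rec (λ r → r < N → g r ≤ r + z) step r
    where
    step : ∀ r → (∀ {k} → k < r → k < N → g k ≤ k + z) → r < N → g r ≤ r + z
    step r ih r<N = ≮⇒≥ λ r+z<gr → case-blocked (blocked r+z<gr)
      where
      case-blocked : ¬ Blocked g r (r + z)
      case-blocked (k , k<r , inj₁ gk≡r+z) =
        <⇒≱ (+-monoˡ-< z k<r) (subst (_≤ k + z) gk≡r+z (ih k<r (<-trans k<r r<N)))
      case-blocked (k , k<r , inj₂ e) =
        miss (<-trans k<r r<N) (+-cancelʳ-≡ r _ _ (trans e (xy∙z≈zy∙x r z k)))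

  InvolutiveBelow : ℕ → Set
  InvolutiveBelow n = ∀ {k} → k < n → g k < n → g (g k) ≡ k

  -- Every m < k is already taken as g (g m) with g m < n: diagonal n − k is first met
  -- at k, so g m ≤ m + (n − k) < n.
  preimage-involutive : ∀ {n k} → InvolutiveBelow n → k < n → g k ≡ n → g n ≡ k
  preimage-involutive {n} {k} inv k<n gk≡n = least-unblocked k-unblocked below-blocked
    where
    open ≡-Reasoning
    not-preimage : ∀ {k′} → k′ < n → g k′ ≢ k
    not-preimage {k′} k′<n gk′≡k = <⇒≢ k′<n (begin
      k′         ≡⟨ inv k′<n (subst (_< n) (sym gk′≡k) k<n) ⟨
      g (g k′)   ≡⟨ cong g gk′≡k ⟩
      g k        ≡⟨ gk≡n ⟩
      n          ∎)
    k-unblocked : ¬ Blocked g n k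
    k-unblocked (k′ , k′<n , inj₁ gk′≡k) = not-preimage k′<n gk′≡k
    k-unblocked (k′ , k′<n , inj₂ e) = not-preimage k′<n (diagonal-injective (begin
        g (g k′) + k  ≡⟨ cong (_+ k) (inv k′<n (<-trans gk′<k′ k′<n)) ⟩
        k′ + k        ≡⟨ +-comm k′ k ⟩
        k + k′        ≡⟨ e ⟨
        g k′ + n      ≡⟨ cong (λ x → g k′ + x) gk≡n ⟨
        g k′ + g k    ≡⟨ +-comm (g k′) (g k) ⟩
        g k + g k′    ∎))
      where
      gk′<k′ : g k′ < k′
      gk′<k′ = +-cancelʳ-< n _ _ (subst₂ _<_ (sym e) (+-comm n k′) (+-monoˡ-< k′ k<n))
    z : ℕ
    z = n ∸ k
    k+z≡n : k + z ≡ n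
    k+z≡n = m+[n∸m]≡n (<⇒≤ k<n)
    below-blocked : ∀ {m} → m < k → Blocked g n m
    below-blocked {m} m<k = g m , gm<n , inj₁ (inv (<-trans m<k k<n) gm<n)
      where
      gm<n : g m < n
      gm<n = subst (g m <_) k+z≡n (≤-<-trans
        (≤diagonal (misses-before (trans gk≡n (sym k+z≡n))) m<k) (+-monoˡ-< z m<k))

  image-involutive : ∀ {n} → InvolutiveBelow n → g n < n → g (g n) ≡ n
  image-involutive {n} inv gn<n with <-cmp (g (g n)) n
  ... | tri< ggn<n _ _ = injective (inv gn<n ggn<n)
  ... | tri≈ _ ggn≡n _ = ggn≡n
  ... | tri> _ _ n<ggn = contradiction (blocked n<ggn) n-unblocked
    where
    open ≡-Reasoning
    n-unblocked : ¬ Blocked g (g n) n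
    n-unblocked (k , k<gn , inj₁ gk≡n) =
      <⇒≢ k<gn (sym (preimage-involutive inv (<-trans k<gn gn<n) gk≡n))
    n-unblocked (k , k<gn , inj₂ e) = <⇒≢ gk<n (diagonal-injective (begin
        g (g k) + n  ≡⟨ cong (_+ n) (inv (<-trans k<gn gn<n) gk<n) ⟩
        k + n        ≡⟨ +-comm k n ⟩
        n + k        ≡⟨ e ⟨
        g k + g n    ≡⟨ +-comm (g k) (g n) ⟩
        g n + g k    ∎))
      where
      gk<n : g k < n
      gk<n = +-cancelʳ-< (g n) _ _ (subst (_< n + g n) (sym e) (+-monoʳ-< n k<gn))

  involutive-below : ∀ n → InvolutiveBelow n
  involutive-below zero    ()
  involutive-below (suc n) {k} k<1+n gk<1+n
    with m<1+n⇒m<n∨m≡n k<1+n | m<1+n⇒m<n∨m≡n gk<1+n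
  ... | inj₁ k<n  | inj₁ gk<n = involutive-below n k<n gk<n
  ... | inj₁ k<n  | inj₂ gk≡n = trans (cong g gk≡n) (preimage-involutive (involutive-below n) k<n gk≡n)
  ... | inj₂ refl | inj₁ gk<k = image-involutive (involutive-below n) gk<k
  ... | inj₂ refl | inj₂ gk≡k = trans (cong g gk≡k) gk≡k

  involutive : ∀ j → g (g j) ≡ j
  involutive j = involutive-below (suc (j + g j)) (s≤s (m≤m+n j (g j))) (s≤s (m≤n+m (g j) j))

  bijective : Bijective _≡_ _≡_ g
  bijective = injective , strictlySurjective⇒surjective λ j → g j , involutive j

  ¬misses-below-twice : ∀ z → ¬ Misses (suc z) (suc z + suc z)
  ¬misses-below-twice z miss =
    let i , j , i<j , j<N , same = pigeonhole-ℕ offset (+-monoʳ-< (suc z) (n<1+n z)) offset<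
    in <⇒≢ i<j (diagonal-injective (offset-injective (<-trans i<j j<N) j<N same))
    where
    open ≡-Reasoning
    N : ℕ
    N = suc z + suc z
    gr<r+1+z : ∀ {r} → r < N → g r < r + suc z
    gr<r+1+z r<N = ≤∧≢⇒< (≤diagonal miss r<N) (miss r<N)
    r≤gr+z : ∀ {r} → r < N → r ≤ g r + z
    r≤gr+z {r} r<N = ≮⇒≥ λ gr+z<r →
      let gr<N = ≤-<-trans (≤-trans (m≤m+n (g r) z) (<⇒≤ gr+z<r)) r<N
      in miss gr<N (subst (_≡ g r + suc z) (sym (involutive r)) (≤-antisym
           (subst (_≤ g r + suc z) (involutive r) (≤diagonal miss gr<N))
           (subst (_≤ r) (sym (+-suc (g r) z)) gr+z<r)))
    offset : ℕ → ℕ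
    offset r = g r + z ∸ r
    offset< : ∀ {r} → r < N → offset r < suc z + z
    offset< {r} r<N = m<n+o⇒m∸n<o (g r + z) r
      (subst (g r + z <_) (+-assoc r (suc z) z) (+-monoˡ-< z (gr<r+1+z r<N)))
    offset-injective : ∀ {i j} → i < N → j < N → offset i ≡ offset j → g i + j ≡ g j + i
    offset-injective {i} {j} i<N j<N same = +-cancelʳ-≡ z _ _ (begin
      (g i + j) + z  ≡⟨ xy∙z≈xz∙y (g i) j z ⟩
      (g i + z) + j  ≡⟨ m∸n≡o∸p⇒m+p≡o+n (r≤gr+z i<N) (r≤gr+z j<N) same ⟩
      (g j + z) + i  ≡⟨ xy∙z≈xz∙y (g j) z i ⟩
      (g j + i) + z  ∎)

  diagonal-attained : ∀ z → ∃[ j ] g j ≡ j + z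
  diagonal-attained zero    = 0 , g0≡0
  diagonal-attained (suc z) with any? (λ k → g k ≟ k + suc z) (upTo (suc z + suc z))
  ... | yes hit  = let j , _ , gj≡j+z = find hit in j , gj≡j+z
  ... | no  none = ⊥-elim (¬misses-below-twice z λ k<N → none ∘ lose (∈-upTo⁺ k<N))

  diagonal : ℕ → ℤ
  diagonal j = + g j - + j

  gj≡j+z⇒diagonal≡z : ∀ {j z} → g j ≡ j + z → diagonal j ≡ + z
  gj≡j+z⇒diagonal≡z {j} {z} gj≡j+z = begin
    + g j - + j      ≡⟨ cong (λ x → + x - + j) gj≡j+z ⟩
    + (j + z) - + j  ≡⟨ ℤ.[+m]-[+n]≡m⊖n (j + z) j ⟩
    (j + z) ℤ.⊖ j    ≡⟨ ℤ.⊖-≥ (m≤m+n j z) ⟩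
    + (j + z ∸ j)    ≡⟨ cong +_ (m+n∸m≡n j z) ⟩
    + z              ∎
    where open ≡-Reasoning

  diagonal-g≡-diagonal : ∀ j → diagonal (g j) ≡ ℤ.- diagonal j
  diagonal-g≡-diagonal j = begin
    + g (g j) - + g j     ≡⟨ cong (λ x → + x - + g j) (involutive j) ⟩
    + j - + g j           ≡⟨ ℤ.[+m]-[+n]≡m⊖n j (g j) ⟩
    j ℤ.⊖ g j             ≡⟨ ℤ.⊖-swap j (g j) ⟩
    ℤ.- (g j ℤ.⊖ j)       ≡⟨ cong ℤ.-_ (ℤ.[+m]-[+n]≡m⊖n (g j) j) ⟨
    ℤ.- (+ g j - + j)     ∎
    where open ≡-Reasoning

  diagonal-bijective : Bijective _≡_ _≡_ diagonal
  diagonal-bijective = injective′ , strictlySurjective⇒surjective surjective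
    where
    injective′ : ∀ {i j} → diagonal i ≡ diagonal j → i ≡ j
    injective′ {i} {j} = diagonal-injective ∘ m-n≡o-p⇒m+p≡o+n {g i} {i} {g j} {j}
    surjective : ∀ w → ∃[ j ] diagonal j ≡ w
    surjective (+ z)     = let j , gj≡j+z = diagonal-attained z in j , gj≡j+z⇒diagonal≡z gj≡j+z
    surjective -[1+ z ]  = let j , gj≡j+z = diagonal-attained (suc z)
                           in g j , trans (diagonal-g≡-diagonal j) (cong ℤ.-_ (gj≡j+z⇒diagonal≡z gj≡j+z))

theorem5p1 : Bijective {A = ℕ} {B = ℕ} _≡_ _≡_ (λ j → q 2 j)
    × Bijective {A = ℕ} {B = ℤ} _≡_ _≡_ (λ j → + q 2 j - + j)
theorem5p1 = bijective , diagonal-bijective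
  where open Greedy q₂-greedy
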